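{- Let $P=(X,\le)$ be a poset and $\mathcal{M}$ a collection of subsets of $X$ containing all singletons. If $P$ is $\mathcal{M}$-continuous, then $\operatorname{int}_{\sigma_{\mathcal{M}}}(\uparrow Y)\subseteq\twoheaduparrow_{\mathcal{M}} Y$ for all $Y\subseteq X$.
   Context: $\mathcal{M}_\vee$ is the set of members of $\mathcal{M}$ with a supremum; $\mathcal{M}^\wedge=\{\downarrow M:M\in\mathcal{M}\}$. $x\ll_{\mathcal{M}} y$ iff for all $M\in\mathcal{M}_\vee$, $y\le\bigvee M$ implies $x\in\downarrow M$. $\twoheaddownarrow_{\mathcal{M}} y=\{x:x\ll_{\mathcal{M}} y\}$; $\twoheaduparrow_{\mathcal{M}} Y=\{x:\exists y\in Y,\ y\ll_{\mathcal{M}} x\}$. $P$ is $\mathcal{M}$-continuous if for every $y$, $\twoheaddownarrow_{\mathcal{M}} y\in\mathcal{M}^\wedge$ and $y=\bigvee\twoheaddownarrow_{\mathcal{M}} y$. $\sigma_{\mathcal{M}}=\{U:U=\uparrow U,\ \forall M\in\mathcal{M}_\vee(\bigvee M\in U\Rightarrow U\cap M\ne\varnothing)\}$; $\operatorname{int}_{\sigma_{\mathcal{M}}}(A)$ is the union of all members of $\sigma_{\mathcal{M}}$ contained in $A$. -}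

module Defs where

open import Level using (Level; _⊔_; suc)
open import Relation.Binary.Bundles using (Poset)
open import Relation.Unary using (Pred; _∈_; _⊆_)
open import Data.Product using (Σ; ∃; _×_; _,_)
open import Function.Bundles using (_⇔_)

module _ {a ℓ₁ ℓ₂ : Level} (P : Poset a ℓ₁ ℓ₂) where
  open Poset P renaming (Carrier to X)

  Collection : (ℓ ℓ' : Level) → Set (a ⊔ suc ℓ ⊔ suc ℓ')
  Collection ℓ ℓ' = Pred (Pred X ℓ) ℓ'

  ⟦_⟧ : ∀ {ℓ} → X → Pred X (ℓ₁ ⊔ ℓ)
  ⟦_⟧ {ℓ} x y = Level.Lift ℓ (y ≈ x)

  ↓_ : ∀ {ℓ} → Pred X ℓ → Pred X (a ⊔ ℓ₂ ⊔ ℓ)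
  (↓ M) x = Σ X λ m → m ∈ M × x ≤ m

  ↑_ : ∀ {ℓ} → Pred X ℓ → Pred X (a ⊔ ℓ₂ ⊔ ℓ)
  (↑ M) x = Σ X λ m → m ∈ M × m ≤ x

  UpperSet : ∀ {ℓ} → Pred X ℓ → Set (a ⊔ ℓ₂ ⊔ ℓ)
  UpperSet U = ∀ {x y} → x ∈ U → x ≤ y → y ∈ U

  IsSup : ∀ {ℓ} → Pred X ℓ → X → Set (a ⊔ ℓ₂ ⊔ ℓ)
  IsSup M s = (∀ m → m ∈ M → m ≤ s) × (∀ u → (∀ m → m ∈ M → m ≤ u) → s ≤ u)

  module _ {ℓ ℓ' : Level} (𝓜 : Collection ℓ ℓ') where

    _≪_ : X → X → Set (a ⊔ ℓ₂ ⊔ suc ℓ ⊔ ℓ')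
    x ≪ y = ∀ (M : Pred X ℓ) → M ∈ 𝓜 → ∀ s → IsSup M s → y ≤ s → x ∈ (↓ M)

    ↡ : X → Pred X (a ⊔ ℓ₂ ⊔ suc ℓ ⊔ ℓ')
    ↡ y x = x ≪ y

    ↟ : ∀ {k} → Pred X k → Pred X (a ⊔ ℓ₂ ⊔ suc ℓ ⊔ ℓ' ⊔ k)
    ↟ Y x = Σ X λ y → y ∈ Y × y ≪ x

    In𝓜∧ : ∀ {k} → Pred X k → Set (a ⊔ ℓ₂ ⊔ suc ℓ ⊔ ℓ' ⊔ k)
    In𝓜∧ A = Σ (Pred X ℓ) λ M → M ∈ 𝓜 × (∀ x → (x ∈ A) ⇔ (x ∈ (↓ M)))

    Continuous : Set (a ⊔ ℓ₂ ⊔ suc ℓ ⊔ ℓ')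
    Continuous = ∀ y → In𝓜∧ (↡ y) × IsSup (↡ y) y

    σ-open : Pred X ℓ → Set (a ⊔ ℓ₂ ⊔ suc ℓ ⊔ ℓ')
    σ-open U = UpperSet U
             × (∀ (M : Pred X ℓ) → M ∈ 𝓜 → ∀ s → IsSup M s → s ∈ U
                  → Σ X λ m → m ∈ M × m ∈ U)

    int : ∀ {k} → Pred X k → Pred X (a ⊔ ℓ₂ ⊔ suc ℓ ⊔ ℓ' ⊔ k)
    int A x = Σ (Pred X ℓ) λ U → σ-open U × U ⊆ A × x ∈ U

module Submission where

-- Let x lie in a σ_𝓜-open set U ⊆ ↑Y.  By 𝓜-continuity the
-- way-below set ↡x equals ↓M for some M ∈ 𝓜, and x = ⋁↡x.  Since a
-- subset and its down-closure have the same upper bounds, x is also the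
-- supremum of M itself, so openness of U yields some m ∈ M ∩ U.  Then
-- m ≪ x (because M ⊆ ↓M = ↡x), and m ∈ U ⊆ ↑Y gives y ∈ Y with y ≤ m.
-- Finally ≪ is downward closed in its left argument, so y ≪ x, i.e.
-- x ∈ ↟Y.

open import Defs
open import Level using (Level; _⊔_)
open import Relation.Binary.Bundles using (Poset)
open import Relation.Unary using (Pred; _∈_; _⊆_)
open import Data.Product using (Σ; _×_; _,_)
open import Function.Bundles using (_⇔_; Equivalence)

module _ {a ℓ₁ ℓ₂ : Level} (P : Poset a ℓ₁ ℓ₂) where
  open Poset P renaming (Carrier to X)

  -- If A coincides extensionally with ↓M, then any supremum of A is a
  -- supremum of M: both sets have exactly the same upper bounds.
  sup-of-↓-is-sup : ∀ {ℓ k} {M : Pred X ℓ} {A : Pred X k} {s : X}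
                  → (∀ x → (x ∈ A) ⇔ (x ∈ ↓_ P M))
                  → IsSup P A s → IsSup P M s
  sup-of-↓-is-sup {M = M} {A} A≡↓M (s-bound , s-least) =
    (λ m m∈M → s-bound m (Equivalence.from (A≡↓M m) (m , m∈M , refl)))
    , (λ u u-bound → s-least u (λ z z∈A → below u u-bound (Equivalence.to (A≡↓M z) z∈A)))
    where
    below : ∀ {z} u → (∀ m → m ∈ M → m ≤ u) → z ∈ ↓_ P M → z ≤ u
    below u u-bound (m , m∈M , z≤m) = trans z≤m (u-bound m m∈M)

  module _ {ℓ ℓ' : Level} (𝓜 : Collection P ℓ ℓ') where

    ≤-≪-trans : ∀ {y m x} → y ≤ m → _≪_ P 𝓜 m x → _≪_ P 𝓜 y x
    ≤-≪-trans y≤m m≪x N N∈𝓜 s s-sup x≤s with m≪x N N∈𝓜 s s-sup x≤s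
    ... | n , n∈N , m≤n = n , n∈N , trans y≤m m≤n

    continuous-basis : Continuous P 𝓜 → ∀ x →
      Σ (Pred X ℓ) λ M → M ∈ 𝓜 × IsSup P M x × (∀ m → m ∈ M → _≪_ P 𝓜 m x)
    continuous-basis cont x with cont x
    ... | (M , M∈𝓜 , ↡x≡↓M) , x-sup =
      M , M∈𝓜 , sup-of-↓-is-sup ↡x≡↓M x-sup
        , (λ m m∈M → Equivalence.from (↡x≡↓M m) (m , m∈M , refl))

lemma3p11 : ∀ {a ℓ₁ ℓ₂ ℓ' k : Level} (P : Poset a ℓ₁ ℓ₂)
    (𝓜 : Collection P (ℓ₁ ⊔ ℓ₂) ℓ')
    → (∀ x → ⟦_⟧ P {ℓ₂} x ∈ 𝓜)
    → Continuous P 𝓜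
    → ∀ (Y : Pred (Poset.Carrier P) k)
    → int P 𝓜 (↑_ P Y) ⊆ ↟ P 𝓜 Y
lemma3p11 P 𝓜 _ cont Y {x} (U , (_ , U-inaccessible) , U⊆↑Y , x∈U)
  with continuous-basis P 𝓜 cont x
... | M , M∈𝓜 , x-sup , M≪x
  with U-inaccessible M M∈𝓜 x x-sup x∈U
... | m , m∈M , m∈U
  with U⊆↑Y m∈U
... | y , y∈Y , y≤m = y , y∈Y , ≤-≪-trans P 𝓜 y≤m (M≪x m m∈M)
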